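{- Let $\mathbb{A}$ be a non-empty set. The following two statements are equivalent: (1) For every finite non-empty set $C$ and every map $\varphi:\mathbb{A}^+\to C$, each periodic word $x\in\mathbb{A}^\omega$ admits a $\varphi$-ultra monochromatic factorization. (2) For every finite non-empty set $C$ and every map $\varphi:\mathbb{N}^+\to C$, there exist $c\in C$ and an infinite sequence $(n_k)_{k=0}^\infty$ of positive integers such that $\mathrm{FS}((n_k)_{k=0}^\infty)=\{\sum_{i\in F}n_i : F\in\mathrm{Fin}(\mathbb{N})\}\subseteq\varphi^{ -1}(c)$.
   Context: $\mathbb{A}^+$ is the free semigroup of non-empty finite words over $\mathbb{A}$, $\mathbb{A}^\omega$ the set of right-infinite words. A word $x\in\mathbb{A}^\omega$ is (purely) periodic if $x=u^\omega=uuu\cdots$ for some $u\in\mathbb{A}^+$. $\mathbb{N}^+$ is the set of positive integers, and $\mathrm{Fin}(\mathbb{N})$ is the set of finite subsets of $\mathbb{N}$ (here understood as non-empty, so that sums are positive). A factorization $x=V_0V_1V_2\cdots$ with $V_i\in\mathbb{A}^+$ is $\varphi$-ultra monochromatic if there is $c\in C$ such that for all $k\ge1$, all $0\le n_1<\cdots<n_k$ and all permutations $\sigma$ of $\{1,\dots,k\}$, $\varphi(V_{n_{\sigma(1)}}\cdots V_{n_{\sigma(k)}})=c$. -}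

module Defs where

open import Data.Nat using (ℕ; zero; suc; _+_; _<_; _%_; NonZero)
open import Data.Fin using (Fin; toℕ) renaming (zero to fzero; suc to fsuc)
open import Data.Fin.Permutation using (Permutation′; _⟨$⟩ʳ_)
open import Data.List using (List; []; _∷_; _++_)
open import Data.List.NonEmpty using (List⁺; _∷_; _⁺++⁺_; toList; length)
open import Data.Product using (Σ; ∃; _×_)
open import Relation.Binary.PropositionalEquality using (_≡_)

-- A⁺ = List⁺ A (non-empty finite words), A^ω = ℕ → A (right-infinite words).

lookupMod : {A : Set} → List⁺ A → ℕ → A
lookupMod {A} u i = go (toList u) (i % length u) (Data.List.NonEmpty.head u)
  where
  go : List A → ℕ → A → A
  go [] _ d = d
  go (a ∷ as) zero d = a
  go (a ∷ as) (suc j) d = go as j d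

omega : {A : Set} → List⁺ A → (ℕ → A)
omega u i = lookupMod u i

-- x is (purely) periodic: x = u^ω for some u ∈ A⁺ (pointwise equality)
Periodic : {A : Set} → (ℕ → A) → Set
Periodic {A} x = Σ (List⁺ A) λ u → ∀ i → x i ≡ omega u i

prefix : {A : Set} → (ℕ → A) → ℕ → List A
prefix x zero = []
prefix x (suc n) = x 0 ∷ prefix (λ i → x (suc i)) n

concatUpto : {A : Set} → (ℕ → List⁺ A) → ℕ → List A
concatUpto V zero = []
concatUpto V (suc n) = concatUpto V n ++ toList (V n)

-- x = V₀ V₁ V₂ ⋯ : every finite concatenation V₀⋯V_{n-1} is a prefix of x
-- (since each Vᵢ is nonempty this determines x completely).
IsFactorization : {A : Set} → (ℕ → A) → (ℕ → List⁺ A) → Set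
IsFactorization x V = ∀ n → prefix x (Data.List.length (concatUpto V n)) ≡ concatUpto V n

concatFin : {A : Set} (k : ℕ) → (Fin (suc k) → List⁺ A) → List⁺ A
concatFin zero W = W fzero
concatFin (suc k) W = W fzero ⁺++⁺ concatFin k (λ i → W (fsuc i))

StrictlyIncreasing : {k : ℕ} → (Fin k → ℕ) → Set
StrictlyIncreasing {k} n = ∀ (i j : Fin k) → toℕ i < toℕ j → n i < n j

-- φ-ultra monochromatic factorization (k ≥ 1 written as k = suc k')
UltraMonochromatic : {A C : Set} → (List⁺ A → C) → (ℕ → List⁺ A) → Set
UltraMonochromatic {A} {C} φ V =
  Σ C λ c → ∀ (k : ℕ) (n : Fin (suc k) → ℕ) → StrictlyIncreasing n →
    (σ : Permutation′ (suc k)) →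
    φ (concatFin k (λ i → V (n (σ ⟨$⟩ʳ i)))) ≡ c

ℕ⁺ : Set
ℕ⁺ = Σ ℕ NonZero

sumFin : (k : ℕ) → (Fin (suc k) → ℕ) → ℕ
sumFin zero f = f fzero
sumFin (suc k) f = f fzero + sumFin k (λ i → f (fsuc i))

-- FS((n_k)) ⊆ φ⁻¹(c): for every finite nonempty F = {i₀ < ⋯ < i_k} ⊆ ℕ,
-- the sum Σ_{i∈F} n_i (which is positive) is coloured c.
FSMonochromatic : {C : Set} → (ℕ⁺ → C) → (ℕ → ℕ) → C → Set
FSMonochromatic φ n c =
  ∀ (k : ℕ) (F : Fin (suc k) → ℕ) → StrictlyIncreasing F →
    (pos : NonZero (sumFin k (λ i → n (F i)))) →
    φ (sumFin k (λ i → n (F i)) Data.Product., pos) ≡ c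

module Submission where

-- Both implications of the theorem are transfers along the length map
-- |_| : A⁺ → ℕ⁺, which turns concatenation into addition.
--
-- (1 ⇒ 2)  Given ψ : ℕ⁺ → C, colour a word by ψ of its length and factorize the
--          constant periodic word a^ω ultra monochromatically.  The lengths of
--          the factors form a sequence all of whose finite sums have colour c
--          (take the identity permutation).
-- (2 ⇒ 1)  Given φ : A⁺ → C and x = u^ω, colour n ∈ ℕ⁺ by φ(uⁿ) and let (N j) be
--          a sequence with monochromatic finite sums.  The factors V j = u^(N j)
--          factorize u^ω, and any product of factors in any order is u^S where S
--          is the (order independent) sum of the chosen N j, so it has colour c.

open import Defs
open import Data.Nat using (ℕ; zero; suc; pred; _+_; _<_; s≤s; z<s; NonZero; >-nonZero)
open import Data.Nat.Properties using (+-comm; +-identityʳ; ≤-pred; ≤-trans; m≤m+n; +-0-commutativeMonoid)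
open import Data.Nat.DivMod using (m<n⇒m%n≡m; [m+n]%n≡m%n; n%1≡0)
open import Data.Fin using (Fin) renaming (zero to fzero; suc to fsuc)
open import Data.Fin.Permutation as Permutation using (Permutation′; _⟨$⟩ʳ_)
open import Data.List using (List; []; _∷_; _++_; length)
open import Data.List.Properties using (length-++; ++-assoc)
open import Data.List.NonEmpty using (List⁺; _∷_; _⁺++_; toList)
  renaming (length to length⁺)
open import Data.List.NonEmpty.Properties using (length-⁺++⁺)
open import Data.Product using (Σ; _×_; _,_; proj₁)
open import Relation.Binary.PropositionalEquality
import Algebra.Properties.CommutativeMonoid.Sum as CommutativeMonoidSum

module ℕSum = CommutativeMonoidSum +-0-commutativeMonoid

letter : {A : Set} → A → List A → ℕ → A
letter d []       _       = d
letter d (a ∷ as) zero    = a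
letter d (a ∷ as) (suc j) = letter d as j

-- Below |u| no reduction modulo |u| takes place, so u^ω reads the letters of u.
omega-below : {A : Set} (h : A) (t : List A) (j : ℕ) → j < suc (length t) →
  lookupMod (h ∷ t) j ≡ letter h (h ∷ t) j
omega-below h t        zero          _       = refl
omega-below h []       (suc j)       (s≤s ())
omega-below h (a ∷ as) (suc zero)    j<|u| rewrite m<n⇒m%n≡m j<|u| = refl
omega-below h (a ∷ as) (suc (suc j)) j<|u| =
  trans dropSecond (omega-below h as (suc j) (≤-pred j<|u|))
  where
  -- deleting the second letter of u moves every later letter one place down
  dropSecond : lookupMod (h ∷ a ∷ as) (suc (suc j)) ≡ lookupMod (h ∷ as) (suc j)
  dropSecond rewrite m<n⇒m%n≡m j<|u| | m<n⇒m%n≡m (≤-pred j<|u|) = refl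

omega-period : {A : Set} (u : List⁺ A) (i : ℕ) → omega u (length⁺ u + i) ≡ omega u i
omega-period u i = trans (cong (omega u) (+-comm (length⁺ u) i)) (period-on-right u)
  where
  period-on-right : (v : List⁺ _) → omega v (i + length⁺ v) ≡ omega v i
  period-on-right (h ∷ t) rewrite [m+n]%n≡m%n i (suc (length t)) ⦃ _ ⦄ = refl

constant-periodic : {A : Set} (a : A) → Periodic (λ _ → a)
constant-periodic a = a ∷ [] , λ i → sym (one-letter i)
  where
  one-letter : (i : ℕ) → omega (a ∷ []) i ≡ a
  one-letter i rewrite n%1≡0 i = refl

prefix-cong : {A : Set} (n : ℕ) (f g : ℕ → A) → (∀ i → i < n → f i ≡ g i) →
  prefix f n ≡ prefix g n
prefix-cong zero    f g f≗g = refl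
prefix-cong (suc n) f g f≗g =
  cong₂ _∷_ (f≗g 0 z<s) (prefix-cong n _ _ (λ i i<n → f≗g (suc i) (s≤s i<n)))

prefix-+ : {A : Set} (a b : ℕ) (f : ℕ → A) →
  prefix f (a + b) ≡ prefix f a ++ prefix (λ i → f (a + i)) b
prefix-+ zero    b f = refl
prefix-+ (suc a) b f = cong (f 0 ∷_) (prefix-+ a b (λ i → f (suc i)))

prefix-letter : {A : Set} (d : A) (l : List A) → prefix (letter d l) (length l) ≡ l
prefix-letter d []       = refl
prefix-letter d (a ∷ as) = cong (a ∷_) (prefix-letter d as)

prefix-omega : {A : Set} (u : List⁺ A) → prefix (omega u) (length⁺ u) ≡ toList u
prefix-omega (h ∷ t) =
  trans (prefix-cong (suc (length t)) _ _ (omega-below h t)) (prefix-letter h (h ∷ t))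

power : {A : Set} → List A → ℕ → List A
power l zero    = []
power l (suc n) = l ++ power l n

power-+ : {A : Set} (l : List A) (a b : ℕ) → power l (a + b) ≡ power l a ++ power l b
power-+ l zero    b = refl
power-+ l (suc a) b =
  trans (cong (l ++_) (power-+ l a b)) (sym (++-assoc l (power l a) (power l b)))

prefix-omega-power : {A : Set} (u : List⁺ A) (T : ℕ) →
  prefix (omega u) (length (power (toList u) T)) ≡ power (toList u) T
prefix-omega-power u zero    = refl
prefix-omega-power u (suc T) = begin
    prefix (omega u) (length (toList u ++ uᵀ))
  ≡⟨ cong (prefix (omega u)) (length-++ (toList u)) ⟩
    prefix (omega u) (length⁺ u + length uᵀ)
  ≡⟨ prefix-+ (length⁺ u) _ (omega u) ⟩
    prefix (omega u) (length⁺ u) ++ prefix (λ i → omega u (length⁺ u + i)) (length uᵀ)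
  ≡⟨ cong₂ _++_ (prefix-omega u) (prefix-cong _ _ _ (λ i _ → omega-period u i)) ⟩
    toList u ++ prefix (omega u) (length uᵀ)
  ≡⟨ cong (toList u ++_) (prefix-omega-power u T) ⟩
    toList u ++ uᵀ
  ∎
  where
  open ≡-Reasoning
  uᵀ = power (toList u) T

-- uⁿ as a non-empty word; meaningful for n ≥ 1 (and equal to u for n = 0).
power⁺ : {A : Set} → List⁺ A → ℕ → List⁺ A
power⁺ u n = u ⁺++ power (toList u) (pred n)

toList-power⁺ : {A : Set} (u : List⁺ A) (n : ℕ) → 0 < n →
  toList (power⁺ u n) ≡ power (toList u) n
toList-power⁺ u (suc n) _ = refl

toList-injective : {A : Set} (v w : List⁺ A) → toList v ≡ toList w → v ≡ w
toList-injective (h ∷ t) (.h ∷ .t) refl = refl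

sumFin-positive : (k : ℕ) (g : Fin (suc k) → ℕ) → (∀ i → 0 < g i) → 0 < sumFin k g
sumFin-positive zero    g g>0 = g>0 fzero
sumFin-positive (suc k) g g>0 = ≤-trans (g>0 fzero) (m≤m+n _ _)

sumFin≡sum : (k : ℕ) (g : Fin (suc k) → ℕ) → sumFin k g ≡ ℕSum.sum g
sumFin≡sum zero    g = sym (+-identityʳ (g fzero))
sumFin≡sum (suc k) g = cong (g fzero +_) (sumFin≡sum k (λ i → g (fsuc i)))

sumFin-permute : (k : ℕ) (g : Fin (suc k) → ℕ) (σ : Permutation′ (suc k)) →
  sumFin k (λ i → g (σ ⟨$⟩ʳ i)) ≡ sumFin k g
sumFin-permute k g σ = begin
    sumFin k (λ i → g (σ ⟨$⟩ʳ i)) ≡⟨ sumFin≡sum k _ ⟩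
    ℕSum.sum (λ i → g (σ ⟨$⟩ʳ i)) ≡⟨ sym (ℕSum.sum-permute g σ) ⟩
    ℕSum.sum g                    ≡⟨ sym (sumFin≡sum k g) ⟩
    sumFin k g                    ∎
  where open ≡-Reasoning

length-concatFin : {A : Set} (k : ℕ) (W : Fin (suc k) → List⁺ A) →
  length⁺ (concatFin k W) ≡ sumFin k (λ i → length⁺ (W i))
length-concatFin zero    W = refl
length-concatFin (suc k) W =
  trans (length-⁺++⁺ (W fzero) (concatFin k (λ i → W (fsuc i))))
        (cong (length⁺ (W fzero) +_) (length-concatFin k (λ i → W (fsuc i))))

concatFin-power⁺ : {A : Set} (u : List⁺ A) (k : ℕ) (g : Fin (suc k) → ℕ) →
  (∀ i → 0 < g i) → toList (concatFin k (λ i → power⁺ u (g i))) ≡ power (toList u) (sumFin k g)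
concatFin-power⁺ u zero    g g>0 = toList-power⁺ u (g fzero) (g>0 fzero)
concatFin-power⁺ u (suc k) g g>0 = begin
    toList (power⁺ u (g fzero)) ++ toList (concatFin k (λ i → power⁺ u (g (fsuc i))))
  ≡⟨ cong₂ _++_ (toList-power⁺ u (g fzero) (g>0 fzero))
                (concatFin-power⁺ u k (λ i → g (fsuc i)) (λ i → g>0 (fsuc i))) ⟩
    power (toList u) (g fzero) ++ power (toList u) (sumFin k (λ i → g (fsuc i)))
  ≡⟨ sym (power-+ (toList u) (g fzero) _) ⟩
    power (toList u) (g fzero + sumFin k (λ i → g (fsuc i)))
  ∎
  where open ≡-Reasoning

-- NonZero is a proposition, so a colouring of ℕ⁺ only sees the number.
nonZero-irrelevant : (n : ℕ) (p q : NonZero n) → p ≡ q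
nonZero-irrelevant zero    () _
nonZero-irrelevant (suc n) p  q = refl

colour-cong : {C : Set} (ψ : ℕ⁺ → C) {s t : ℕ} (p : NonZero s) (q : NonZero t) →
  s ≡ t → ψ (s , p) ≡ ψ (t , q)
colour-cong ψ {s} p q refl = cong (λ r → ψ (s , r)) (nonZero-irrelevant s p q)

length⁺-nonZero : {A : Set} (w : List⁺ A) → NonZero (length⁺ w)
length⁺-nonZero (h ∷ t) = _

length⁺-positive : {A : Set} (w : List⁺ A) → 0 < length⁺ w
length⁺-positive (h ∷ t) = z<s

PeriodicUltra : Set → Set
PeriodicUltra A = ∀ (m : ℕ) (φ : List⁺ A → Fin (suc m)) (x : ℕ → A) → Periodic x →
  Σ (ℕ → List⁺ A) λ V → IsFactorization x V × UltraMonochromatic φ V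

Hindman : Set
Hindman = ∀ (m : ℕ) (φ : ℕ⁺ → Fin (suc m)) →
  Σ (Fin (suc m)) λ c → Σ (ℕ → ℕ) λ n → (∀ k → 0 < n k) × FSMonochromatic φ n c

periodicUltra⇒hindman : (A : Set) → A → PeriodicUltra A → Hindman
periodicUltra⇒hindman A a ultra m ψ
  with ultra m byLength (λ _ → a) (constant-periodic a)
  where
  byLength : List⁺ A → Fin (suc m)
  byLength w = ψ (length⁺ w , length⁺-nonZero w)
... | V , _ , c , mono = c , lengths , (λ k → length⁺-positive (V k)) , finiteSums
  where
  lengths : ℕ → ℕ
  lengths k = length⁺ (V k)
  finiteSums : FSMonochromatic ψ lengths c
  finiteSums k F increasing nz =
    trans (colour-cong ψ nz _ (sym (length-concatFin k (λ i → V (F i)))))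
          (mono k F increasing Permutation.id)

hindman⇒periodicUltra : (A : Set) → Hindman → PeriodicUltra A
hindman⇒periodicUltra A hindman m φ x (u , x≗u^ω)
  with hindman m (λ s → φ (power⁺ u (proj₁ s)))
... | c , N , N>0 , finiteSums = V , factorization , c , mono
  where
  V : ℕ → List⁺ A
  V j = power⁺ u (N j)

  exponent : ℕ → ℕ
  exponent zero    = 0
  exponent (suc j) = exponent j + N j

  concatUpto-power : ∀ j → concatUpto V j ≡ power (toList u) (exponent j)
  concatUpto-power zero    = refl
  concatUpto-power (suc j) =
    trans (cong₂ _++_ (concatUpto-power j) (toList-power⁺ u (N j) (N>0 j)))
          (sym (power-+ (toList u) (exponent j) (N j)))

  factorization : IsFactorization x V
  factorization j rewrite concatUpto-power j =
    trans (prefix-cong _ x (omega u) (λ i _ → x≗u^ω i)) (prefix-omega-power u (exponent j))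

  mono : ∀ (k : ℕ) (n : Fin (suc k) → ℕ) → StrictlyIncreasing n → (σ : Permutation′ (suc k)) →
    φ (concatFin k (λ i → V (n (σ ⟨$⟩ʳ i)))) ≡ c
  mono k n increasing σ =
    trans (cong φ (toList-injective _ _ concat≡power)) (finiteSums k n increasing (>-nonZero S>0))
    where
    S>0 : 0 < sumFin k (λ i → N (n i))
    S>0 = sumFin-positive k _ (λ i → N>0 (n i))
    concat≡power : toList (concatFin k (λ i → V (n (σ ⟨$⟩ʳ i))))
                 ≡ toList (power⁺ u (sumFin k (λ i → N (n i))))
    concat≡power = begin
        toList (concatFin k (λ i → V (n (σ ⟨$⟩ʳ i))))
      ≡⟨ concatFin-power⁺ u k (λ i → N (n (σ ⟨$⟩ʳ i))) (λ i → N>0 _) ⟩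
        power (toList u) (sumFin k (λ i → N (n (σ ⟨$⟩ʳ i))))
      ≡⟨ cong (power (toList u)) (sumFin-permute k (λ i → N (n i)) σ) ⟩
        power (toList u) (sumFin k (λ i → N (n i)))
      ≡⟨ sym (toList-power⁺ u _ S>0) ⟩
        toList (power⁺ u (sumFin k (λ i → N (n i))))
      ∎
      where open ≡-Reasoning

theorem2p7 : (A : Set) → (a : A) →
    ((∀ (m : ℕ) (φ : List⁺ A → Fin (suc m)) (x : ℕ → A) → Periodic x →
        Σ (ℕ → List⁺ A) λ V → IsFactorization x V × UltraMonochromatic φ V)
      →
     (∀ (m : ℕ) (φ : ℕ⁺ → Fin (suc m)) →
        Σ (Fin (suc m)) λ c → Σ (ℕ → ℕ) λ n → (∀ k → 0 < n k) × FSMonochromatic φ n c))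
    ×
    ((∀ (m : ℕ) (φ : ℕ⁺ → Fin (suc m)) →
        Σ (Fin (suc m)) λ c → Σ (ℕ → ℕ) λ n → (∀ k → 0 < n k) × FSMonochromatic φ n c)
      →
     (∀ (m : ℕ) (φ : List⁺ A → Fin (suc m)) (x : ℕ → A) → Periodic x →
        Σ (ℕ → List⁺ A) λ V → IsFactorization x V × UltraMonochromatic φ V))
theorem2p7 A a = periodicUltra⇒hindman A a , hindman⇒periodicUltra A
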